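{- Consider the two-player finite bimatrix game in which the row player (the Magician) and the column player (the Physician) each choose one of four pure strategies $A, B, C, D$, with row player's payoff matrix $$M=\begin{pmatrix} 0 & 0 & 1 & 0\\ 1 & 0 & 0 & 0\\ 0 & 0 & 1/2 & 1/2\\ 0 & 1 & 0 & 0\end{pmatrix}$$ and column player's payoff matrix $$P=\begin{pmatrix} 0 & 1 & 0 & 0\\ 0 & 0 & 0 & 1\\ 1 & 0 & 1/2 & 0\\ 0 & 0 & 1/2 & 0\end{pmatrix},$$ where rows and columns are indexed in the order $A,B,C,D$ (entry $(i,j)$ is the payoff when the row player plays strategy $i$ and the column player plays strategy $j$). Then this game has exactly three Nash equilibria in mixed strategies, namely: (1) both players choose each of $A,B,C,D$ with probability $1/4$; (2) the row player chooses $B$ and $C$ each with probability $1/2$, and the column player chooses $A$ with probability $1/3$ and $D$ with probability $2/3$; (3) the column player chooses $B$ and $C$ each with probability $1/2$, and the row player chooses $A$ with probability $1/3$ and $D$ with probability $2/3$. In equilibrium (1) each player's expected payoff is $1/4$; in equilibria (2) and (3) the player mixing over $A$ and $D$ has expected payoff $1/2$ and the player mixing over $B$ and $C$ has expected payoff $1/3$.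
   Context: A mixed strategy for a player is a probability distribution on $\{A,B,C,D\}$. If the row player uses mixed strategy $x$ and the column player uses $y$ (as probability vectors), the expected payoffs are $x^{T}My$ and $x^{T}Py$ respectively. A Nash equilibrium is a pair $(x,y)$ such that neither player can increase their own expected payoff by changing their own mixed strategy while the other's strategy is held fixed.
   Formalization: The mixed strategies of both players, including the deviating strategies in the equilibrium condition, assign only rational probabilities to A, B, C, D. -}

module Defs where

open import Data.Fin using (Fin; zero; suc)
open import Data.Integer using (+_)
open import Data.Rational using (ℚ; _+_; _*_; _≤_; _/_; 0ℚ; 1ℚ; ½)
open import Data.Vec using (Vec; _∷_; []; lookup)
open import Data.Product using (_×_)
open import Relation.Binary.PropositionalEquality using (_≡_)

-- Strategies A,B,C,D are indexed by Fin 4 in this order (A = 0, …, D = 3).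
Strategy : Set
Strategy = Fin 4

Σ4 : (Fin 4 → ℚ) → ℚ
Σ4 f = f zero + f (suc zero) + f (suc (suc zero)) + f (suc (suc (suc zero)))

Matrix : Set
Matrix = Fin 4 → Fin 4 → ℚ

fromRows : Vec (Vec ℚ 4) 4 → Matrix
fromRows m i j = lookup (lookup m i) j

M : Matrix
M = fromRows
  ( (0ℚ ∷ 0ℚ ∷ 1ℚ ∷ 0ℚ ∷ [])
  ∷ (1ℚ ∷ 0ℚ ∷ 0ℚ ∷ 0ℚ ∷ [])
  ∷ (0ℚ ∷ 0ℚ ∷ ½  ∷ ½  ∷ [])
  ∷ (0ℚ ∷ 1ℚ ∷ 0ℚ ∷ 0ℚ ∷ [])
  ∷ [])

P : Matrix
P = fromRows
  ( (0ℚ ∷ 1ℚ ∷ 0ℚ ∷ 0ℚ ∷ [])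
  ∷ (0ℚ ∷ 0ℚ ∷ 0ℚ ∷ 1ℚ ∷ [])
  ∷ (1ℚ ∷ 0ℚ ∷ ½  ∷ 0ℚ ∷ [])
  ∷ (0ℚ ∷ 0ℚ ∷ ½  ∷ 0ℚ ∷ [])
  ∷ [])

IsMixed : (Fin 4 → ℚ) → Set
IsMixed x = (∀ i → 0ℚ ≤ x i) × Σ4 x ≡ 1ℚ

payoff : Matrix → (Fin 4 → ℚ) → (Fin 4 → ℚ) → ℚ
payoff Q x y = Σ4 λ i → Σ4 λ j → x i * Q i j * y j

IsNash : (Fin 4 → ℚ) → (Fin 4 → ℚ) → Set
IsNash x y =
  IsMixed x × IsMixed y
  × (∀ x′ → IsMixed x′ → payoff M x′ y ≤ payoff M x y)
  × (∀ y′ → IsMixed y′ → payoff P x y′ ≤ payoff P x y)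

vec4 : ℚ → ℚ → ℚ → ℚ → (Fin 4 → ℚ)
vec4 a b c d = lookup (a ∷ b ∷ c ∷ d ∷ [])

quarter third twoThirds : ℚ
quarter = + 1 / 4
third = + 1 / 3
twoThirds = + 2 / 3

uniform : Fin 4 → ℚ
uniform = vec4 quarter quarter quarter quarter

halfBC : Fin 4 → ℚ
halfBC = vec4 0ℚ ½ ½ 0ℚ

thirdAD : Fin 4 → ℚ
thirdAD = vec4 third 0ℚ 0ℚ twoThirds

SameProfile : (Fin 4 → ℚ) → (Fin 4 → ℚ) → (Fin 4 → ℚ) → (Fin 4 → ℚ) → Set
SameProfile x y x₀ y₀ = (∀ i → x i ≡ x₀ i) × (∀ j → y j ≡ y₀ j)

{-# OPTIONS --safe #-}
module Submission where

-- Since P is the transpose of M, both players face the same payoff vector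
-- against an opponent mix y = (a, b, c, d): strategies A, B, C, D earn
-- c, a, (c + d)/2 and b.  At an equilibrium every strategy in a player's
-- support earns the maximal payoff, which is positive; hence if i is in the
-- support of one player then "next i" (A ↦ C ↦ D ↦ B ↦ A) is in the support
-- of the other (for i = C because (c + d)/2 = max ≥ c forces d ≥ max).
-- This links the eight strategy slots into the two cycles
-- x_A → y_C → x_D → y_B → x_A and x_B → y_A → x_C → y_D → x_B, each lying
-- entirely inside or entirely outside the supports.  The three possible
-- support patterns leave linear indifference equations with unique solutions.

open import Defs
open import Data.Bool using (if_then_else_)
open import Data.Empty using (⊥-elim)
open import Data.Fin using (Fin; zero; suc)
open import Data.Fin.Properties using (all?) renaming (_≟_ to _≟ᶠ_)
open import Data.Product using (_×_; _,_; proj₁; proj₂)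
open import Data.Rational using (ℚ; ½; 0ℚ; 1ℚ; _+_; _*_; -_; _≤_; _<_; nonNegative; positive)
open import Data.Rational.Properties
open import Data.Sum using (_⊎_; inj₁; inj₂)
open import Data.Unit using (tt)
open import Function.Bundles using (_⇔_; mk⇔; Equivalence)
open import Relation.Binary.PropositionalEquality
open import Relation.Nullary using (¬_; Dec; yes; no; does)
open import Relation.Nullary.Decidable using (toWitness; _×-dec_; dec⇒maybe)
import Tactic.RingSolver.Core.AlmostCommutativeRing as ACR
open import Tactic.RingSolver using (solve-∀)

pattern A = zero
pattern B = suc zero
pattern C = suc (suc zero)
pattern D = suc (suc (suc zero))

ℚ-ring : ACR.AlmostCommutativeRing _ _
ℚ-ring = ACR.fromCommutativeRing +-*-commutativeRing (λ x → dec⇒maybe (0ℚ ≟ x))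

Vector : Set
Vector = Fin 4 → ℚ

variable
  a b u : ℚ
  f g v w x y x₀ y₀ : Vector
  i : Strategy

nonNeg⇒≡0⊎pos : 0ℚ ≤ a → a ≡ 0ℚ ⊎ 0ℚ < a
nonNeg⇒≡0⊎pos {a} 0≤a with 0ℚ <? a
... | yes 0<a = inj₂ 0<a
... | no  0≮a = inj₁ (≤-antisym (≮⇒≥ 0≮a) 0≤a)

b≡mean+mean-a : ∀ a b → b ≡ (a + b) * ½ + (a + b) * ½ + - a
b≡mean+mean-a = solve-∀ ℚ-ring

u≡u+u-u : ∀ u → u ≡ u + u + - u
u≡u+u-u = solve-∀ ℚ-ring

mean-≥ : (a + b) * ½ ≡ u → a ≤ u → u ≤ b
mean-≥ {a} {b} {u} mean a≤u = begin
  u                                  ≡⟨ u≡u+u-u u ⟩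
  u + u + - u                        ≤⟨ +-monoʳ-≤ (u + u) (neg-antimono-≤ a≤u) ⟩
  u + u + - a                        ≡⟨ cong (λ m → m + m + - a) (sym mean) ⟩
  (a + b) * ½ + (a + b) * ½ + - a    ≡⟨ sym (b≡mean+mean-a a b) ⟩
  b                                  ∎
  where open ≤-Reasoning

mean-≡ : (a + b) * ½ ≡ u → a ≡ u → b ≡ u
mean-≡ {a} {b} {u} mean a≡u = begin
  b                                  ≡⟨ b≡mean+mean-a a b ⟩
  (a + b) * ½ + (a + b) * ½ + - a    ≡⟨ cong₂ (λ m n → m + m + - n) mean a≡u ⟩
  u + u + - u                        ≡⟨ sym (u≡u+u-u u) ⟩
  u                                  ∎
  where open ≡-Reasoning

AllPositiveOrAllZero : ℚ → ℚ → ℚ → ℚ → Set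
AllPositiveOrAllZero u₁ u₂ u₃ u₄ =
  (0ℚ < u₁ × 0ℚ < u₂ × 0ℚ < u₃ × 0ℚ < u₄) ⊎ (u₁ ≡ 0ℚ × u₂ ≡ 0ℚ × u₃ ≡ 0ℚ × u₄ ≡ 0ℚ)

cycle-positivity :
  ∀ {u₁ u₂ u₃ u₄} → 0ℚ ≤ u₁ → 0ℚ ≤ u₂ → 0ℚ ≤ u₃ → 0ℚ ≤ u₄ →
  (0ℚ < u₁ → 0ℚ < u₂) → (0ℚ < u₂ → 0ℚ < u₃) → (0ℚ < u₃ → 0ℚ < u₄) → (0ℚ < u₄ → 0ℚ < u₁) →
  AllPositiveOrAllZero u₁ u₂ u₃ u₄
cycle-positivity {u₂ = u₂} {u₃} {u₄} n₁ n₂ n₃ n₄ p₁₂ p₂₃ p₃₄ p₄₁ with nonNeg⇒≡0⊎pos n₁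
... | inj₂ pos₁ = inj₁ (pos₁ , p₁₂ pos₁ , p₂₃ (p₁₂ pos₁) , p₃₄ (p₂₃ (p₁₂ pos₁)))
... | inj₁ zero₁ = inj₂ (zero₁ , zero₂ , zero₃ , zero₄)
  where
  zero-before : ∀ {s t} → 0ℚ ≤ s → (0ℚ < s → 0ℚ < t) → t ≡ 0ℚ → s ≡ 0ℚ
  zero-before 0≤s s⇒t t≡0 with nonNeg⇒≡0⊎pos 0≤s
  ... | inj₁ s≡0 = s≡0
  ... | inj₂ 0<s = ⊥-elim (<-irrefl (sym t≡0) (s⇒t 0<s))
  zero₄ : u₄ ≡ 0ℚ
  zero₄ = zero-before n₄ p₄₁ zero₁
  zero₃ : u₃ ≡ 0ℚ
  zero₃ = zero-before n₃ p₃₄ zero₄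
  zero₂ : u₂ ≡ 0ℚ
  zero₂ = zero-before n₂ p₂₃ zero₃

Σ4-cong : f ≗ g → Σ4 f ≡ Σ4 g
Σ4-cong f≗g = cong₂ _+_ (cong₂ _+_ (cong₂ _+_ (f≗g A) (f≗g B)) (f≗g C)) (f≗g D)

Σ4-mono-≤ : (∀ i → f i ≤ g i) → Σ4 f ≤ Σ4 g
Σ4-mono-≤ f≤g = +-mono-≤ (+-mono-≤ (+-mono-≤ (f≤g A) (f≤g B)) (f≤g C)) (f≤g D)

Σ4-mono-< : ∀ i → (∀ j → f j ≤ g j) → f i < g i → Σ4 f < Σ4 g
Σ4-mono-< A f≤g fi<gi = +-mono-<-≤ (+-mono-<-≤ (+-mono-<-≤ fi<gi (f≤g B)) (f≤g C)) (f≤g D)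
Σ4-mono-< B f≤g fi<gi = +-mono-<-≤ (+-mono-<-≤ (+-mono-≤-< (f≤g A) fi<gi) (f≤g C)) (f≤g D)
Σ4-mono-< C f≤g fi<gi = +-mono-<-≤ (+-mono-≤-< (+-mono-≤ (f≤g A) (f≤g B)) fi<gi) (f≤g D)
Σ4-mono-< D f≤g fi<gi = +-mono-≤-< (+-mono-≤ (+-mono-≤ (f≤g A) (f≤g B)) (f≤g C)) fi<gi

Σ4-+ : ∀ f g → Σ4 (λ i → f i + g i) ≡ Σ4 f + Σ4 g
Σ4-+ f g = regroup (f A) (f B) (f C) (f D) (g A) (g B) (g C) (g D)
  where
  regroup : ∀ a b c d e f g h →
    (a + e) + (b + f) + (c + g) + (d + h) ≡ (a + b + c + d) + (e + f + g + h)
  regroup = solve-∀ ℚ-ring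

Σ4-*-distribˡ : ∀ t f → Σ4 (λ i → t * f i) ≡ t * Σ4 f
Σ4-*-distribˡ t f = distrib t (f A) (f B) (f C) (f D)
  where
  distrib : ∀ t a b c d → t * a + t * b + t * c + t * d ≡ t * (a + b + c + d)
  distrib = solve-∀ ℚ-ring

Σ4-*-distribʳ : ∀ t f → Σ4 (λ i → f i * t) ≡ Σ4 f * t
Σ4-*-distribʳ t f = distrib t (f A) (f B) (f C) (f D)
  where
  distrib : ∀ t a b c d → a * t + b * t + c * t + d * t ≡ (a + b + c + d) * t
  distrib = solve-∀ ℚ-ring

Σ4-comm : ∀ (h : Fin 4 → Fin 4 → ℚ) → Σ4 (λ i → Σ4 (h i)) ≡ Σ4 (λ j → Σ4 (λ i → h i j))
Σ4-comm h = begin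
  Σ4 (λ i → h i A + h i B + h i C + h i D)
    ≡⟨ Σ4-+ (λ i → h i A + h i B + h i C) (λ i → h i D) ⟩
  Σ4 (λ i → h i A + h i B + h i C) + Σ4 (λ i → h i D)
    ≡⟨ cong (_+ Σ4 (λ i → h i D)) (Σ4-+ (λ i → h i A + h i B) (λ i → h i C)) ⟩
  Σ4 (λ i → h i A + h i B) + Σ4 (λ i → h i C) + Σ4 (λ i → h i D)
    ≡⟨ cong (λ s → s + Σ4 (λ i → h i C) + Σ4 (λ i → h i D)) (Σ4-+ (λ i → h i A) (λ i → h i B)) ⟩
  Σ4 (λ i → h i A) + Σ4 (λ i → h i B) + Σ4 (λ i → h i C) + Σ4 (λ i → h i D)
    ∎
  where open ≡-Reasoning

infix 7 _∙_
_∙_ : Vector → Vector → ℚ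
x ∙ v = Σ4 λ i → x i * v i

∙-cong : x ≗ x₀ → v ≗ w → x ∙ v ≡ x₀ ∙ w
∙-cong x≗x₀ v≗w = Σ4-cong λ i → cong₂ _*_ (x≗x₀ i) (v≗w i)

∙-const : IsMixed x → x ∙ (λ _ → u) ≡ u
∙-const {x} {u} (_ , Σx≡1) = begin
  x ∙ (λ _ → u)   ≡⟨ Σ4-*-distribʳ u x ⟩
  Σ4 x * u        ≡⟨ cong (_* u) Σx≡1 ⟩
  1ℚ * u          ≡⟨ *-identityˡ u ⟩
  u               ∎
  where open ≡-Reasoning

∙-≤ : IsMixed x → (∀ i → v i ≤ u) → x ∙ v ≤ u
∙-≤ {x} mx v≤u = ≤-trans
  (Σ4-mono-≤ λ i → *-monoˡ-≤-nonNeg (x i) {{nonNegative (proj₁ mx i)}} (v≤u i))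
  (≤-reflexive (∙-const mx))

pure : Strategy → Vector
pure i j = if does (i ≟ᶠ j) then 1ℚ else 0ℚ

∙-pure : ∀ i v → pure i ∙ v ≡ v i
∙-pure A v = select (v A) (v B) (v C) (v D)
  where
  select : ∀ a b c d → 1ℚ * a + 0ℚ * b + 0ℚ * c + 0ℚ * d ≡ a
  select = solve-∀ ℚ-ring
∙-pure B v = select (v A) (v B) (v C) (v D)
  where
  select : ∀ a b c d → 0ℚ * a + 1ℚ * b + 0ℚ * c + 0ℚ * d ≡ b
  select = solve-∀ ℚ-ring
∙-pure C v = select (v A) (v B) (v C) (v D)
  where
  select : ∀ a b c d → 0ℚ * a + 0ℚ * b + 1ℚ * c + 0ℚ * d ≡ c
  select = solve-∀ ℚ-ring
∙-pure D v = select (v A) (v B) (v C) (v D)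
  where
  select : ∀ a b c d → 0ℚ * a + 0ℚ * b + 0ℚ * c + 1ℚ * d ≡ d
  select = solve-∀ ℚ-ring

infixr 7 _*ᵥ_
_*ᵥ_ : Matrix → Vector → Vector
(Q *ᵥ y) i = Q i ∙ y

payoff≡∙*ᵥ : ∀ Q x y → payoff Q x y ≡ x ∙ (Q *ᵥ y)
payoff≡∙*ᵥ Q x y = Σ4-cong λ i →
  trans (Σ4-cong λ j → *-assoc (x i) (Q i j) (y j)) (Σ4-*-distribˡ (x i) (λ j → Q i j * y j))

payoff-transpose : ∀ Q R x y → (∀ i j → Q i j ≡ R j i) → payoff Q x y ≡ payoff R y x
payoff-transpose Q R x y Q≡Rᵀ =
  trans (Σ4-comm (λ i j → x i * Q i j * y j)) (Σ4-cong λ j → Σ4-cong λ i → transposed i j)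
  where
  swap-outer : ∀ a m b → a * m * b ≡ b * m * a
  swap-outer = solve-∀ ℚ-ring
  transposed : ∀ i j → x i * Q i j * y j ≡ y j * R j i * x i
  transposed i j = trans (cong (λ q → x i * q * y j) (Q≡Rᵀ i j)) (swap-outer (x i) (R j i) (y j))

P≡Mᵀ : ∀ i j → P i j ≡ M j i
P≡Mᵀ = toWitness {a? = all? λ i → all? λ j → P i j ≟ M j i} tt

payoffs : Vector → Vector
payoffs y = vec4 (y C) (y A) ((y C + y D) * ½) (y B)

-- Rows A, B and D of M are the pure strategies C, A and B.
M*ᵥ≗payoffs : ∀ y → M *ᵥ y ≗ payoffs y
M*ᵥ≗payoffs y A = ∙-pure C y
M*ᵥ≗payoffs y B = ∙-pure A y
M*ᵥ≗payoffs y C = average (y A) (y B) (y C) (y D)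
  where
  average : ∀ a b c d → 0ℚ * a + 0ℚ * b + ½ * c + ½ * d ≡ (c + d) * ½
  average = solve-∀ ℚ-ring
M*ᵥ≗payoffs y D = ∙-pure B y

payoff-M : ∀ x y → payoff M x y ≡ x ∙ payoffs y
payoff-M x y = trans (payoff≡∙*ᵥ M x y) (∙-cong {x = x} (λ _ → refl) (M*ᵥ≗payoffs y))

payoff-P : ∀ x y → payoff P x y ≡ y ∙ payoffs x
payoff-P x y = trans (payoff-transpose P M x y P≡Mᵀ) (payoff-M y x)

IsBestResponse : Vector → Vector → Set
IsBestResponse v x = IsMixed x × (∀ i → v i ≤ x ∙ v)

isMixed? : ∀ x → Dec (IsMixed x)
isMixed? x = all? (λ i → 0ℚ ≤? x i) ×-dec (Σ4 x ≟ 1ℚ)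

isBestResponse? : ∀ v x → Dec (IsBestResponse v x)
isBestResponse? v x = isMixed? x ×-dec all? (λ i → v i ≤? x ∙ v)

pure-isMixed : ∀ i → IsMixed (pure i)
pure-isMixed = toWitness {a? = all? λ i → isMixed? (pure i)} tt

optimal⇒bestResponse : IsMixed x → (∀ x′ → IsMixed x′ → x′ ∙ v ≤ x ∙ v) → IsBestResponse v x
optimal⇒bestResponse {x = x} {v = v} mx optimal =
  mx , λ i → subst (_≤ x ∙ v) (∙-pure i v) (optimal (pure i) (pure-isMixed i))

bestResponse⇒optimal : IsBestResponse v x → ∀ x′ → IsMixed x′ → x′ ∙ v ≤ x ∙ v
bestResponse⇒optimal (_ , bound) x′ mx′ = ∙-≤ mx′ bound

MutualBestResponses : Vector → Vector → Set
MutualBestResponses x y = IsBestResponse (payoffs y) x × IsBestResponse (payoffs x) y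

nash⇔mutualBestResponses : IsNash x y ⇔ MutualBestResponses x y
nash⇔mutualBestResponses {x = x} {y = y} = mk⇔
  (λ (mx , my , row , col) →
      optimal⇒bestResponse mx (λ x′ m → subst₂ _≤_ (payoff-M x′ y) (payoff-M x y) (row x′ m))
    , optimal⇒bestResponse my (λ y′ m → subst₂ _≤_ (payoff-P x y′) (payoff-P x y) (col y′ m)))
  (λ (brx , bry) → proj₁ brx , proj₁ bry
    , (λ x′ m → subst₂ _≤_ (sym (payoff-M x′ y)) (sym (payoff-M x y)) (bestResponse⇒optimal brx x′ m))
    , (λ y′ m → subst₂ _≤_ (sym (payoff-P x y′)) (sym (payoff-P x y)) (bestResponse⇒optimal bry y′ m)))

attains-on-support : IsBestResponse v x → 0ℚ < x i → v i ≡ x ∙ v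
attains-on-support {v = v} {x = x} {i = i} (mx , bound) 0<xi with v i <? x ∙ v
... | no  vi≮max = ≤-antisym (bound i) (≮⇒≥ vi≮max)
... | yes vi<max = ⊥-elim (<-irrefl refl (begin-strict
  x ∙ v              <⟨ Σ4-mono-< i weighted-bound (*-monoʳ-<-pos (x i) {{positive 0<xi}} vi<max) ⟩
  x ∙ (λ _ → x ∙ v)  ≡⟨ ∙-const mx ⟩
  x ∙ v              ∎))
  where
  open ≤-Reasoning
  weighted-bound : ∀ j → x j * v j ≤ x j * (x ∙ v)
  weighted-bound j = *-monoˡ-≤-nonNeg (x j) {{nonNegative (proj₁ mx j)}} (bound j)

payoffs-bound⇒positive : IsMixed y → (∀ i → payoffs y i ≤ u) → 0ℚ < u
payoffs-bound⇒positive {y = y} {u = u} (_ , Σy≡1) bound with 0ℚ <? u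
... | yes 0<u = 0<u
... | no  0≮u = ⊥-elim (<-irrefl refl (begin-strict
  0ℚ                                                 <⟨ positive⁻¹ 1ℚ ⟩
  1ℚ                                                 ≡⟨ sym Σy≡1 ⟩
  Σ4 y                                               ≡⟨ split-mean (y A) (y B) (y C) (y D) ⟩
  y A + y B + (y C + y D) * ½ + (y C + y D) * ½      ≤⟨ +-mono-≤ (+-mono-≤ (+-mono-≤ (bound B) (bound D)) (bound C)) (bound C) ⟩
  u + u + u + u                                      ≤⟨ +-mono-≤ (+-mono-≤ (+-mono-≤ u≤0 u≤0) u≤0) u≤0 ⟩
  0ℚ                                                 ∎))
  where
  open ≤-Reasoning
  u≤0 : u ≤ 0ℚ
  u≤0 = ≮⇒≥ 0≮u
  split-mean : ∀ a b c d → a + b + c + d ≡ a + b + (c + d) * ½ + (c + d) * ½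
  split-mean = solve-∀ ℚ-ring

next : Strategy → Strategy
next A = C
next B = A
next C = D
next D = B

support-next : IsBestResponse (payoffs y) x → IsMixed y → 0ℚ < x i → 0ℚ < y (next i)
support-next {y = y} {x = x} {i = i} br my 0<xi = step i (attains-on-support br 0<xi)
  where
  0<max : 0ℚ < x ∙ payoffs y
  0<max = payoffs-bound⇒positive my (proj₂ br)
  step : ∀ i → payoffs y i ≡ x ∙ payoffs y → 0ℚ < y (next i)
  step A yC≡max    = subst (0ℚ <_) (sym yC≡max) 0<max
  step B yA≡max    = subst (0ℚ <_) (sym yA≡max) 0<max
  step C mean≡max  = <-≤-trans 0<max (mean-≥ mean≡max (proj₂ br A))
  step D yB≡max    = subst (0ℚ <_) (sym yB≡max) 0<max

quarters : u + u + u + u ≡ 1ℚ → u ≡ quarter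
quarters {u = u} 4u≡1 = trans (solve-quarter u) (cong (_* quarter) 4u≡1)
  where
  solve-quarter : ∀ u → u ≡ (u + u + u + u) * quarter
  solve-quarter = solve-∀ ℚ-ring

halves : 0ℚ + u + u + 0ℚ ≡ 1ℚ → u ≡ ½
halves {u = u} 2u≡1 = trans (solve-half u) (cong (_* ½) 2u≡1)
  where
  solve-half : ∀ u → u ≡ (0ℚ + u + u + 0ℚ) * ½
  solve-half = solve-∀ ℚ-ring

thirds : a ≡ (0ℚ + b) * ½ → a + 0ℚ + 0ℚ + b ≡ 1ℚ → a ≡ third × b ≡ twoThirds
thirds {b = b} refl sum≡1 = cong (λ t → (0ℚ + t) * ½) b≡⅔ , b≡⅔
  where
  solve-twoThirds : ∀ b → b ≡ ((0ℚ + b) * ½ + 0ℚ + 0ℚ + b) * twoThirds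
  solve-twoThirds = solve-∀ ℚ-ring
  b≡⅔ : b ≡ twoThirds
  b≡⅔ = trans (solve-twoThirds b) (cong (_* twoThirds) sum≡1)

full-support⇒uniform : IsBestResponse (payoffs y) x → IsMixed y → (∀ i → 0ℚ < x i) → y ≗ uniform
full-support⇒uniform {y = y} {x = x} br (_ , Σy≡1) 0<x = λ
  { A → trans (y≡max A) max≡¼
  ; B → trans (y≡max B) max≡¼
  ; C → trans (y≡max C) max≡¼
  ; D → trans (y≡max D) max≡¼
  }
  where
  indifferent : ∀ i → payoffs y i ≡ x ∙ payoffs y
  indifferent i = attains-on-support br (0<x i)
  y≡max : ∀ i → y i ≡ x ∙ payoffs y
  y≡max A = indifferent B
  y≡max B = indifferent D
  y≡max C = indifferent A
  y≡max D = mean-≡ (indifferent C) (indifferent A)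
  max≡¼ : x ∙ payoffs y ≡ quarter
  max≡¼ = quarters (trans (sym (Σ4-cong y≡max)) Σy≡1)

AD-support⇒halfBC : IsBestResponse (payoffs x) y → IsMixed x → 0ℚ < y A → 0ℚ < y D →
                    x A ≡ 0ℚ → x D ≡ 0ℚ → x ≗ halfBC
AD-support⇒halfBC {x = x} br (_ , Σx≡1) 0<yA 0<yD xA≡0 xD≡0 = λ
  { A → xA≡0
  ; B → xB≡½
  ; C → trans xC≡xB xB≡½
  ; D → xD≡0
  }
  where
  xC≡xB : x C ≡ x B
  xC≡xB = trans (attains-on-support br 0<yA) (sym (attains-on-support br 0<yD))
  xB≡½ : x B ≡ ½
  xB≡½ = halves (trans (sym (Σ4-cong {f = x} {g = vec4 0ℚ (x B) (x B) 0ℚ} λ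
    { A → xA≡0 ; B → refl ; C → xC≡xB ; D → xD≡0 })) Σx≡1)

BC-support⇒thirdAD : IsBestResponse (payoffs y) x → IsMixed y → 0ℚ < x B → 0ℚ < x C →
                     y B ≡ 0ℚ → y C ≡ 0ℚ → y ≗ thirdAD
BC-support⇒thirdAD {y = y} br (_ , Σy≡1) 0<xB 0<xC yB≡0 yC≡0 = λ
  { A → proj₁ solution
  ; B → yB≡0
  ; C → yC≡0
  ; D → proj₂ solution
  }
  where
  yA≡mean : y A ≡ (0ℚ + y D) * ½
  yA≡mean = trans (attains-on-support br 0<xB)
                  (trans (sym (attains-on-support br 0<xC)) (cong (λ c → (c + y D) * ½) yC≡0))
  solution : y A ≡ third × y D ≡ twoThirds
  solution = thirds yA≡mean (trans (sym (Σ4-cong {f = y} {g = vec4 (y A) 0ℚ 0ℚ (y D)} λ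
    { A → refl ; B → yB≡0 ; C → yC≡0 ; D → refl })) Σy≡1)

mixed⇒nonzero : IsMixed x → ¬ (x ≗ λ _ → 0ℚ)
mixed⇒nonzero (_ , Σx≡1) x≡0 with trans (sym (Σ4-cong x≡0)) Σx≡1
... | ()

ListedProfile : Vector → Vector → Set
ListedProfile x y =
  SameProfile x y uniform uniform ⊎ SameProfile x y halfBC thirdAD ⊎ SameProfile x y thirdAD halfBC

mutualBestResponses⇒listed : MutualBestResponses x y → ListedProfile x y
mutualBestResponses⇒listed {x = x} {y = y} (brx , bry) = by-supports
  (cycle-positivity (0≤x B) (0≤y A) (0≤x C) (0≤y D) row col row col)
  (cycle-positivity (0≤x A) (0≤y C) (0≤x D) (0≤y B) row col row col)
  where
  0≤x : ∀ i → 0ℚ ≤ x i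
  0≤x = proj₁ (proj₁ brx)
  0≤y : ∀ i → 0ℚ ≤ y i
  0≤y = proj₁ (proj₁ bry)
  row : ∀ {i} → 0ℚ < x i → 0ℚ < y (next i)
  row = support-next brx (proj₁ bry)
  col : ∀ {i} → 0ℚ < y i → 0ℚ < x (next i)
  col = support-next bry (proj₁ brx)
  by-supports : AllPositiveOrAllZero (x B) (y A) (x C) (y D) →
                AllPositiveOrAllZero (x A) (y C) (x D) (y B) → ListedProfile x y
  by-supports (inj₁ (0<xB , 0<yA , 0<xC , 0<yD)) (inj₁ (0<xA , 0<yC , 0<xD , 0<yB)) =
    inj₁ ( full-support⇒uniform bry (proj₁ brx) (λ { A → 0<yA ; B → 0<yB ; C → 0<yC ; D → 0<yD })
         , full-support⇒uniform brx (proj₁ bry) (λ { A → 0<xA ; B → 0<xB ; C → 0<xC ; D → 0<xD }))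
  by-supports (inj₁ (0<xB , 0<yA , 0<xC , 0<yD)) (inj₂ (xA≡0 , yC≡0 , xD≡0 , yB≡0)) =
    inj₂ (inj₁ ( AD-support⇒halfBC bry (proj₁ brx) 0<yA 0<yD xA≡0 xD≡0
               , BC-support⇒thirdAD brx (proj₁ bry) 0<xB 0<xC yB≡0 yC≡0))
  by-supports (inj₂ (xB≡0 , yA≡0 , xC≡0 , yD≡0)) (inj₁ (0<xA , 0<yC , 0<xD , 0<yB)) =
    inj₂ (inj₂ ( BC-support⇒thirdAD bry (proj₁ brx) 0<yB 0<yC xB≡0 xC≡0
               , AD-support⇒halfBC brx (proj₁ bry) 0<xA 0<xD yA≡0 yD≡0))
  by-supports (inj₂ (xB≡0 , _ , xC≡0 , _)) (inj₂ (xA≡0 , _ , xD≡0 , _)) =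
    ⊥-elim (mixed⇒nonzero (proj₁ brx) λ { A → xA≡0 ; B → xB≡0 ; C → xC≡0 ; D → xD≡0 })

IsMixed-resp : x ≗ x₀ → IsMixed x₀ → IsMixed x
IsMixed-resp x≗x₀ (0≤x₀ , Σx₀≡1) =
  (λ i → subst (0ℚ ≤_) (sym (x≗x₀ i)) (0≤x₀ i)) , trans (Σ4-cong x≗x₀) Σx₀≡1

IsBestResponse-resp : v ≗ w → x ≗ x₀ → IsBestResponse w x₀ → IsBestResponse v x
IsBestResponse-resp v≗w x≗x₀ (mx₀ , bound) =
  IsMixed-resp x≗x₀ mx₀ , λ i → subst₂ _≤_ (sym (v≗w i)) (sym (∙-cong x≗x₀ v≗w)) (bound i)

payoffs-cong : y ≗ y₀ → payoffs y ≗ payoffs y₀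
payoffs-cong y≗y₀ A = y≗y₀ C
payoffs-cong y≗y₀ B = y≗y₀ A
payoffs-cong y≗y₀ C = cong (_* ½) (cong₂ _+_ (y≗y₀ C) (y≗y₀ D))
payoffs-cong y≗y₀ D = y≗y₀ B

mutualBestResponses? : ∀ x y → Dec (MutualBestResponses x y)
mutualBestResponses? x y = isBestResponse? (payoffs y) x ×-dec isBestResponse? (payoffs x) y

SameProfile⇒mutualBestResponses :
  MutualBestResponses x₀ y₀ → SameProfile x y x₀ y₀ → MutualBestResponses x y
SameProfile⇒mutualBestResponses (brx₀ , bry₀) (x≗x₀ , y≗y₀) =
  IsBestResponse-resp (payoffs-cong y≗y₀) x≗x₀ brx₀ , IsBestResponse-resp (payoffs-cong x≗x₀) y≗y₀ bry₀

listed⇒mutualBestResponses : ListedProfile x y → MutualBestResponses x y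
listed⇒mutualBestResponses (inj₁ same) =
  SameProfile⇒mutualBestResponses (toWitness {a? = mutualBestResponses? uniform uniform} tt) same
listed⇒mutualBestResponses (inj₂ (inj₁ same)) =
  SameProfile⇒mutualBestResponses (toWitness {a? = mutualBestResponses? halfBC thirdAD} tt) same
listed⇒mutualBestResponses (inj₂ (inj₂ same)) =
  SameProfile⇒mutualBestResponses (toWitness {a? = mutualBestResponses? thirdAD halfBC} tt) same

mainTheorem1 :
    ((x y : Fin 4 → ℚ) →
      IsNash x y ⇔
        (SameProfile x y uniform uniform
         ⊎ SameProfile x y halfBC thirdAD
         ⊎ SameProfile x y thirdAD halfBC))
    × (payoff M uniform uniform ≡ quarter × payoff P uniform uniform ≡ quarter)
    × (payoff M halfBC thirdAD ≡ third × payoff P halfBC thirdAD ≡ ½)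
    × (payoff M thirdAD halfBC ≡ ½ × payoff P thirdAD halfBC ≡ third)
mainTheorem1 =
  (λ x y → mk⇔
    (λ nash → mutualBestResponses⇒listed (Equivalence.to nash⇔mutualBestResponses nash))
    (λ listed → Equivalence.from nash⇔mutualBestResponses (listed⇒mutualBestResponses listed)))
  , (refl , refl) , (refl , refl) , (refl , refl)
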